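{- For all $n\geq 0$: - $cut_r$ is a bijection from $\mathcal{A}_{*,0}(n+1)$ onto $\mathcal{A}(n)$, and from $\mathcal{A}_{1,0}(n+1)$ onto $\mathcal{A}_{0,*}(n)$; - $cut_c$ is a bijection from $\mathcal{A}_{0,*}(n+1)$ onto $\mathcal{A}(n)$, and from $\mathcal{A}_{0,1}(n+1)$ onto $\mathcal{A}_{*,0}(n)$. Consequently $|\mathcal{A}(n)|=|\mathcal{A}_{0,*}(n+1)|=|\mathcal{A}_{*,0}(n+1)|=|\mathcal{A}_{0,1}(n+2)|=|\mathcal{A}_{1,0}(n+2)|$.
   Context: A shape of length $n$ is a Ferrers diagram in English notation (rows left-justified, stacked from the top), in which empty rows and empty columns are allowed. It is determined by its south-east border, a lattice path of $n$ unit steps, each south or west, from the top-right corner to the bottom-left corner. Each south step is the right end of a row and each west step is the bottom of a column. An alternative tableau is a shape together with a partial filling of its cells by left arrows $\leftarrow$ and up arrows $\uparrow$ such that every cell lying to the left of a left arrow in the same row, and every cell lying above an up arrow in the same column, is empty. Its length is the length of its shape. A free row is a row containing no left arrow; a free column is a column containing no up arrow. $\mathcal{A}(n)$ is the set of alternative tableaux of length $n$, and $\mathcal{A}_{i,j}(n)$ the subset of those with exactly $i$ free rows and $j$ free columns. A $*$ in place of $i$ (resp. $j$) means that the number of free rows (resp. free columns) is unrestricted. The operation $cut_r$ deletes the topmost row of a tableau that has at least one row and no empty column. The operation $cut_c$ deletes the leftmost column of a tableau that has at least one column and no empty row. -}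

module Defs where

open import Data.Nat using (ℕ; zero; suc)
open import Data.Bool using (Bool; true; false; _∧_; not)
open import Data.Fin using (Fin; zero; suc; _<_)
open import Data.Fin.Base using (fromℕ)
open import Data.Maybe using (Maybe; just; nothing; fromMaybe)
open import Data.Vec using (Vec; []; _∷_; lookup; removeAt; map)
open import Data.List using (List; length; filterᵇ; allFin)
open import Data.Bool.ListAction using (any)
open import Data.List.Relation.Unary.Unique.Propositional using (Unique)
open import Data.List.Membership.Propositional using (_∈_)
open import Data.Product using (Σ; _×_; ∃)
open import Relation.Binary.PropositionalEquality using (_≡_; _≢_)
open import Relation.Nullary using (¬_)
open import Function.Bundles using (_⇔_)

-- Shapes: the south-east border, a word of n steps S (south) / W (west),
-- read from the top-right corner to the bottom-left corner.
-- Position i of the word with step S is a row (the k-th S from the start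
-- is the k-th row from the top); position j with step W is a column (later
-- W steps are further to the left).

data Step : Set where
  S W : Step

data Fill : Set where
  emp left up : Fill

-- A (raw) filled shape of length n: the border word, and an n×n matrix
-- indexed by pairs of positions (row position, column position).
record Raw (n : ℕ) : Set where
  constructor raw
  field
    shape : Vec Step n
    fill  : Vec (Vec Fill n) n

open Raw public

entry : ∀ {n} → Raw n → Fin n → Fin n → Fill
entry t i j = lookup (lookup (fill t) i) j

IsCell : ∀ {n} → Raw n → Fin n → Fin n → Set
IsCell t i j = lookup (shape t) i ≡ S × lookup (shape t) j ≡ W × i < j

-- Alternative tableau of length n (the matrix is required to be emp
-- outside the cells of the shape, so that a tableau has a unique encoding).
record IsAlt {n : ℕ} (t : Raw n) : Set where
  field
    outside : ∀ i j → ¬ IsCell t i j → entry t i j ≡ emp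
    -- every cell to the left of a left arrow (same row) is empty
    leftOK  : ∀ i j j′ → entry t i j ≡ left → IsCell t i j′ → j < j′ → entry t i j′ ≡ emp
    -- every cell above an up arrow (same column) is empty
    upOK    : ∀ i i′ j → entry t i j ≡ up → IsCell t i′ j → i′ < i → entry t i′ j ≡ emp

isS isW : Step → Bool
isS S = true
isS W = false
isW S = false
isW W = true

isLeft isUp : Fill → Bool
isLeft left = true
isLeft _    = false
isUp up = true
isUp _  = false

isFreeRow : ∀ {n} → Raw n → Fin n → Bool
isFreeRow {n} t i = isS (lookup (shape t) i) ∧ not (any (λ j → isLeft (entry t i j)) (allFin n))

isFreeCol : ∀ {n} → Raw n → Fin n → Bool
isFreeCol {n} t j = isW (lookup (shape t) j) ∧ not (any (λ i → isUp (entry t i j)) (allFin n))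

freeRows freeCols : ∀ {n} → Raw n → ℕ
freeRows {n} t = length (filterᵇ (isFreeRow t) (allFin n))
freeCols {n} t = length (filterᵇ (isFreeCol t) (allFin n))

𝒜 : ∀ n → Raw n → Set
𝒜 n t = IsAlt t

𝒜*0 𝒜10 𝒜0* 𝒜01 : ∀ n → Raw n → Set
𝒜*0 n t = IsAlt t × freeCols t ≡ 0
𝒜10 n t = IsAlt t × freeRows t ≡ 1 × freeCols t ≡ 0
𝒜0* n t = IsAlt t × freeRows t ≡ 0
𝒜01 n t = IsAlt t × freeRows t ≡ 0 × freeCols t ≡ 1

firstS : ∀ {n} → Vec Step n → Maybe (Fin n)
firstS [] = nothing
firstS (S ∷ xs) = just zero
firstS (W ∷ xs) with firstS xs
... | just k  = just (suc k)
... | nothing = nothing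

lastW : ∀ {n} → Vec Step n → Maybe (Fin n)
lastW [] = nothing
lastW (x ∷ xs) with lastW xs
... | just k  = just (suc k)
... | nothing = isWhere x
  where
  isWhere : Step → Maybe (Fin _)
  isWhere W = just zero
  isWhere S = nothing

deleteAt : ∀ {n} → Raw (suc n) → Fin (suc n) → Raw n
deleteAt t k = raw (removeAt (shape t) k) (removeAt (map (λ r → removeAt r k) (fill t)) k)

-- cut_r: delete the topmost row (removing the first S step of the border
-- deletes the top row of the shape).  Only meaningful when a row exists;
-- the fallback value is irrelevant for the statement.
cutr : ∀ {n} → Raw (suc n) → Raw n
cutr t = deleteAt t (fromMaybe zero (firstS (shape t)))

-- cut_c: delete the leftmost column (the last W step of the border).
cutc : ∀ {n} → Raw (suc n) → Raw n
cutc {n} t = deleteAt t (fromMaybe (fromℕ n) (lastW (shape t)))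

BijOn : ∀ {A B : Set} → (A → B) → (A → Set) → (B → Set) → Set
BijOn {A} {B} f P Q =
  (∀ x → P x → Q (f x)) ×
  (∀ x y → P x → P y → f x ≡ f y → x ≡ y) ×
  (∀ y → Q y → Σ A (λ x → P x × f x ≡ y))

HasCard : ∀ {n} → (Raw n → Set) → ℕ → Set
HasCard {n} P k = Σ (List (Raw n)) (λ l → Unique l × (∀ x → (x ∈ l) ⇔ P x) × length l ≡ k)

module Submission where

-- Both cut operations delete one step k of the border word together with
-- the line (row or column) attached to it: cut_r deletes the first step,
-- which must be S, and cut_c the last step, which must be W.  Each cut is
-- inverted by an explicit extension:
--   * addTopRow t puts a new top row above t carrying an up arrow in every
--     free column of t, and nothing else;
--   * addLeftColumn t puts a new leftmost column carrying a left arrow in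
--     every free row of t, and nothing else.
-- addTopRow kills all free columns and adds exactly one free row (the new
-- one); conversely in a tableau without free columns the top row is forced
-- to be exactly this row.  Dually for columns.  So on each of the four
-- domains of the statement the cut and the extension are mutually inverse,
-- which gives the four bijections, and transports any enumeration of the
-- target to one of the source; starting from a brute-force enumeration of
-- 𝒜(n) this yields the chain of equal cardinalities.

open import Defs
open import Algebra.Bundles using (CommutativeMonoid)
open import Data.Nat using (ℕ; zero; suc; _+_; z<s)
open import Data.Nat.Properties using (+-commutativeSemigroup; suc-injective; <⇒≱)
import Data.Nat.Properties as ℕₚ
open import Data.Bool using (Bool; true; false; _∧_; _∨_; not)
open import Data.Bool.Properties using (∧-zeroʳ; ∨-zeroʳ; ¬-not; ∨-commutativeMonoid)
open import Data.Bool.ListAction using (any)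
open import Data.Fin using (Fin; zero; suc; punchIn; fromℕ; _<_)
open import Data.Fin.Properties
  using (_≟_; _<?_; all?; ≤fromℕ; punchInᵢ≢i; punchOut-punchIn; punchIn-punchOut;
         punchIn-mono-≤; punchIn-cancel-≤; punchIn-injective; ≤∧≢⇒<; <⇒≢)
open import Data.Vec using (Vec; []; _∷_; lookup; removeAt; insertAt; tabulate; zipWith)
import Data.Vec as Vec
open import Data.Vec.Properties
  using (lookup∘tabulate; tabulate∘lookup; tabulate-cong; lookup-map; lookup-zipWith;
         insertAt-lookup; insertAt-punchIn; removeAt-punchOut; ∷-injectiveˡ; ∷-injectiveʳ)
open import Data.List using (List; length; filterᵇ; filter; cartesianProductWith)
import Data.List as List
open import Data.List.Properties using (length-map)
open import Data.List.Relation.Unary.All using ([]; _∷_)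
open import Data.List.Relation.Unary.AllPairs using ([]; _∷_)
open import Data.List.Relation.Unary.Any using (here; there)
open import Data.List.Relation.Unary.Unique.Propositional using (Unique)
open import Data.List.Relation.Unary.Unique.Propositional.Properties
  using (map⁺; filter⁺; cartesianProductWith⁺)
open import Data.List.Membership.Propositional using (_∈_)
open import Data.List.Membership.Propositional.Properties
  using (∈-map⁺; ∈-map⁻; ∈-filter⁺; ∈-filter⁻; ∈-cartesianProductWith⁺)
open import Data.Maybe using (just; fromMaybe)
open import Data.Product using (_×_; _,_; proj₁; proj₂; ∃)
open import Data.Sum using (_⊎_; inj₁; inj₂)
open import Data.Empty using (⊥-elim)
open import Function using (_∘_; id)
open import Function.Bundles using (_⇔_; mk⇔; Equivalence)
open import Relation.Binary.PropositionalEquality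
open import Relation.Nullary using (¬_; Dec; yes; no)
open import Relation.Nullary.Decidable using (_×-dec_; _→-dec_; ¬?; map′)
open import Algebra.Properties.CommutativeSemigroup +-commutativeSemigroup
  using () renaming (x∙yz≈y∙xz to +-exchange)
open import Algebra.Properties.CommutativeSemigroup
  (CommutativeMonoid.commutativeSemigroup ∨-commutativeMonoid)
  using () renaming (x∙yz≈y∙xz to ∨-exchange)

bit : Bool → ℕ
bit true  = 1
bit false = 0

anyFin : ∀ {n} → (Fin n → Bool) → Bool
anyFin {zero}  p = false
anyFin {suc n} p = p zero ∨ anyFin (p ∘ suc)

countFin : ∀ {n} → (Fin n → Bool) → ℕ
countFin {zero}  p = 0
countFin {suc n} p = bit (p zero) + countFin (p ∘ suc)

any-tabulate : ∀ {n} {A : Set} (p : A → Bool) (f : Fin n → A) →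
               any p (List.tabulate f) ≡ anyFin (p ∘ f)
any-tabulate {zero}  p f = refl
any-tabulate {suc n} p f = cong (p (f zero) ∨_) (any-tabulate p (f ∘ suc))

length-filter-tabulate : ∀ {n} {A : Set} (p : A → Bool) (f : Fin n → A) →
                         length (filterᵇ p (List.tabulate f)) ≡ countFin (p ∘ f)
length-filter-tabulate {zero}  p f = refl
length-filter-tabulate {suc n} p f with p (f zero)
... | true  = cong suc (length-filter-tabulate p (f ∘ suc))
... | false = length-filter-tabulate p (f ∘ suc)

anyFin-cong : ∀ {n} {p q : Fin n → Bool} → (∀ i → p i ≡ q i) → anyFin p ≡ anyFin q
anyFin-cong {zero}  e = refl
anyFin-cong {suc n} e = cong₂ _∨_ (e zero) (anyFin-cong (e ∘ suc))

countFin-cong : ∀ {n} {p q : Fin n → Bool} → (∀ i → p i ≡ q i) → countFin p ≡ countFin q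
countFin-cong {zero}  e = refl
countFin-cong {suc n} e = cong₂ _+_ (cong bit (e zero)) (countFin-cong (e ∘ suc))

anyFin-punchIn : ∀ {n} (k : Fin (suc n)) (p : Fin (suc n) → Bool) →
                 anyFin p ≡ p k ∨ anyFin (p ∘ punchIn k)
anyFin-punchIn zero            p = refl
anyFin-punchIn {suc n} (suc k) p =
  trans (cong (p zero ∨_) (anyFin-punchIn k (p ∘ suc))) (∨-exchange (p zero) (p (suc k)) _)

countFin-punchIn : ∀ {n} (k : Fin (suc n)) (p : Fin (suc n) → Bool) →
                   countFin p ≡ bit (p k) + countFin (p ∘ punchIn k)
countFin-punchIn zero            p = refl
countFin-punchIn {suc n} (suc k) p =
  trans (cong (bit (p zero) +_) (countFin-punchIn k (p ∘ suc)))
        (+-exchange (bit (p zero)) (bit (p (suc k))) _)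

anyFin-witness : ∀ {n} {p : Fin n → Bool} → anyFin p ≡ true → ∃ λ i → p i ≡ true
anyFin-witness {suc n} {p} e with p zero in eq
... | true  = zero , eq
... | false = let (i , q) = anyFin-witness e in suc i , q

anyFin-intro : ∀ {n} {p : Fin n → Bool} i → p i ≡ true → anyFin p ≡ true
anyFin-intro {p = p} zero    e = cong (_∨ anyFin (p ∘ suc)) e
anyFin-intro {p = p} (suc i) e =
  trans (cong (p zero ∨_) (anyFin-intro {p = p ∘ suc} i e)) (∨-zeroʳ (p zero))

anyFin-none : ∀ {n} {p : Fin n → Bool} → (∀ i → p i ≡ false) → anyFin p ≡ false
anyFin-none {zero}  e = refl
anyFin-none {suc n} e = cong₂ _∨_ (e zero) (anyFin-none (e ∘ suc))

countFin-none : ∀ {n} {p : Fin n → Bool} → (∀ i → p i ≡ false) → countFin p ≡ 0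
countFin-none {zero}  e = refl
countFin-none {suc n} e = cong₂ _+_ (cong bit (e zero)) (countFin-none (e ∘ suc))

countFin-zero : ∀ {n} {p : Fin n → Bool} → countFin p ≡ 0 → ∀ i → p i ≡ false
countFin-zero {suc n} {p} e i with p zero in eq
countFin-zero {suc n} {p} e zero    | false = eq
countFin-zero {suc n} {p} e (suc i) | false = countFin-zero e i

data Position {n} (k : Fin (suc n)) : Fin (suc n) → Set where
  at    : Position k k
  other : ∀ i → Position k (punchIn k i)

position : ∀ {n} (k i : Fin (suc n)) → Position k i
position k i with i ≟ k
... | yes refl = at
... | no  i≢k  = subst (Position k) (punchIn-punchOut (i≢k ∘ sym)) (other _)

punchIn-mono-< : ∀ {n} (k : Fin (suc n)) {i j} → i < j → punchIn k i < punchIn k j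
punchIn-mono-< k {i} {j} i<j =
  ≤∧≢⇒< (punchIn-mono-≤ k i j (ℕₚ.<⇒≤ i<j)) (<⇒≢ i<j ∘ punchIn-injective k i j)

punchIn-cancel-< : ∀ {n} (k : Fin (suc n)) {i j} → punchIn k i < punchIn k j → i < j
punchIn-cancel-< k {i} {j} lt =
  ≤∧≢⇒< (punchIn-cancel-≤ k i j (ℕₚ.<⇒≤ lt)) (<⇒≢ lt ∘ cong (punchIn k))

fromℕ-maximal : ∀ {n} (j : Fin (suc n)) → ¬ (fromℕ n < j)
fromℕ-maximal j lt = <⇒≱ lt (≤fromℕ j)

punchIn-fromℕ-< : ∀ {n} (i : Fin n) → punchIn (fromℕ n) i < fromℕ n
punchIn-fromℕ-< {n} i = ≤∧≢⇒< (≤fromℕ (punchIn (fromℕ n) i)) (punchInᵢ≢i (fromℕ n) i)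

stepAt : ∀ {n} → Raw n → Fin n → Step
stepAt t i = lookup (shape t) i

vec-ext : ∀ {n} {A : Set} {u v : Vec A n} → (∀ i → lookup u i ≡ lookup v i) → u ≡ v
vec-ext {u = u} {v} e = trans (sym (tabulate∘lookup u)) (trans (tabulate-cong e) (tabulate∘lookup v))

raw-ext : ∀ {n} {t u : Raw n} → (∀ i → stepAt t i ≡ stepAt u i) →
          (∀ i j → entry t i j ≡ entry u i j) → t ≡ u
raw-ext {t = raw s f} {raw s′ f′} es ee = cong₂ raw (vec-ext es) (vec-ext (vec-ext ∘ ee))

-- insertStep k s r c t: insert the step s at position k; the new line k
-- carries r (entries (k , punchIn k j)) and c (entries (punchIn k i , k)).
insertStep : ∀ {n} (k : Fin (suc n)) → Step → (r c : Fin n → Fill) → Raw n → Raw (suc n)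
insertStep k s r c t =
  raw (insertAt (shape t) k s)
      (insertAt (zipWith (λ row x → insertAt row k x) (fill t) (tabulate c)) k
                (insertAt (tabulate r) k emp))

module _ {n} (k : Fin (suc n)) (s : Step) (r c : Fin n → Fill) (t : Raw n) where

  private
    T : Raw (suc n)
    T = insertStep k s r c t
    oldRows : Vec (Vec Fill (suc n)) n
    oldRows = zipWith (λ row x → insertAt row k x) (fill t) (tabulate c)
    newRow : Vec Fill (suc n)
    newRow  = insertAt (tabulate r) k emp

    oldRow : ∀ i → lookup (fill T) (punchIn k i) ≡ insertAt (lookup (fill t) i) k (c i)
    oldRow i = begin
      lookup (insertAt oldRows k newRow) (punchIn k i)       ≡⟨ insertAt-punchIn oldRows k newRow i ⟩
      lookup oldRows i                                       ≡⟨ lookup-zipWith _ i (fill t) (tabulate c) ⟩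
      insertAt (lookup (fill t) i) k (lookup (tabulate c) i) ≡⟨ cong (insertAt _ k) (lookup∘tabulate c i) ⟩
      insertAt (lookup (fill t) i) k (c i)                   ∎
      where open ≡-Reasoning

  insertStep-at : stepAt T k ≡ s
  insertStep-at = insertAt-lookup (shape t) k s

  insertStep-other : ∀ i → stepAt T (punchIn k i) ≡ stepAt t i
  insertStep-other = insertAt-punchIn (shape t) k s

  insertEntry-kk : entry T k k ≡ emp
  insertEntry-kk = trans (cong (λ v → lookup v k) (insertAt-lookup oldRows k newRow))
                         (insertAt-lookup (tabulate r) k emp)

  insertEntry-kp : ∀ j → entry T k (punchIn k j) ≡ r j
  insertEntry-kp j = trans (cong (λ v → lookup v (punchIn k j)) (insertAt-lookup oldRows k newRow))
                           (trans (insertAt-punchIn (tabulate r) k emp j) (lookup∘tabulate r j))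

  insertEntry-pk : ∀ i → entry T (punchIn k i) k ≡ c i
  insertEntry-pk i = trans (cong (λ v → lookup v k) (oldRow i))
                           (insertAt-lookup (lookup (fill t) i) k (c i))

  insertEntry-pp : ∀ i j → entry T (punchIn k i) (punchIn k j) ≡ entry t i j
  insertEntry-pp i j = trans (cong (λ v → lookup v (punchIn k j)) (oldRow i))
                             (insertAt-punchIn (lookup (fill t) i) k (c i) j)

  cell-insertStep⁺ : ∀ i j → IsCell t i j → IsCell T (punchIn k i) (punchIn k j)
  cell-insertStep⁺ i j (si , sj , i<j) =
    trans (insertStep-other i) si , trans (insertStep-other j) sj , punchIn-mono-< k i<j

  cell-insertStep⁻ : ∀ i j → IsCell T (punchIn k i) (punchIn k j) → IsCell t i j
  cell-insertStep⁻ i j (si , sj , lt) =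
    trans (sym (insertStep-other i)) si , trans (sym (insertStep-other j)) sj , punchIn-cancel-< k lt

lookup-removeAt : ∀ {n} {A : Set} (v : Vec A (suc n)) k i → lookup (removeAt v k) i ≡ lookup v (punchIn k i)
lookup-removeAt v k i = trans (cong (lookup (removeAt v k)) (sym (punchOut-punchIn k)))
                              (removeAt-punchOut v (punchInᵢ≢i k i ∘ sym))

stepAt-deleteAt : ∀ {n} (t : Raw (suc n)) k i → stepAt (deleteAt t k) i ≡ stepAt t (punchIn k i)
stepAt-deleteAt t k = lookup-removeAt (shape t) k

entry-deleteAt : ∀ {n} (t : Raw (suc n)) k i j →
                 entry (deleteAt t k) i j ≡ entry t (punchIn k i) (punchIn k j)
entry-deleteAt {n} t k i j = begin
  lookup (lookup (removeAt rows k) i) j                   ≡⟨ cong (λ v → lookup v j) (lookup-removeAt rows k i) ⟩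
  lookup (lookup rows (punchIn k i)) j                    ≡⟨ cong (λ v → lookup v j) (lookup-map (punchIn k i) (λ v → removeAt v k) (fill t)) ⟩
  lookup (removeAt (lookup (fill t) (punchIn k i)) k) j   ≡⟨ lookup-removeAt (lookup (fill t) (punchIn k i)) k j ⟩
  entry t (punchIn k i) (punchIn k j)                     ∎
  where
  open ≡-Reasoning
  rows : Vec (Vec Fill n) (suc n)
  rows = Vec.map (λ v → removeAt v k) (fill t)

cell-deleteAt⁺ : ∀ {n} (t : Raw (suc n)) k i j → IsCell (deleteAt t k) i j → IsCell t (punchIn k i) (punchIn k j)
cell-deleteAt⁺ t k i j (si , sj , i<j) =
  trans (sym (stepAt-deleteAt t k i)) si , trans (sym (stepAt-deleteAt t k j)) sj , punchIn-mono-< k i<j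

cell-deleteAt⁻ : ∀ {n} (t : Raw (suc n)) k i j → IsCell t (punchIn k i) (punchIn k j) → IsCell (deleteAt t k) i j
cell-deleteAt⁻ t k i j (si , sj , lt) =
  trans (stepAt-deleteAt t k i) si , trans (stepAt-deleteAt t k j) sj , punchIn-cancel-< k lt

deleteAt-insertStep : ∀ {n} k s r c (t : Raw n) → deleteAt (insertStep k s r c t) k ≡ t
deleteAt-insertStep k s r c t =
  raw-ext (λ i → trans (stepAt-deleteAt T k i) (insertStep-other k s r c t i))
          (λ i j → trans (entry-deleteAt T k i j) (insertEntry-pp k s r c t i j))
  where T = insertStep k s r c t

insertStep-deleteAt : ∀ {n} (t : Raw (suc n)) k s r c → stepAt t k ≡ s → entry t k k ≡ emp →
  (∀ j → entry t k (punchIn k j) ≡ r j) → (∀ i → entry t (punchIn k i) k ≡ c i) →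
  t ≡ insertStep k s r c (deleteAt t k)
insertStep-deleteAt {n} t k s r c ek ekk er ec = raw-ext steps entries
  where
  d : Raw n
  d = deleteAt t k
  steps : ∀ i → stepAt t i ≡ stepAt (insertStep k s r c d) i
  steps i with position k i
  ... | at      = trans ek (sym (insertStep-at k s r c d))
  ... | other i′ = sym (trans (insertStep-other k s r c d i′) (stepAt-deleteAt t k i′))
  entries : ∀ i j → entry t i j ≡ entry (insertStep k s r c d) i j
  entries i j with position k i | position k j
  ... | at       | at       = trans ekk (sym (insertEntry-kk k s r c d))
  ... | at       | other j′ = trans (er j′) (sym (insertEntry-kp k s r c d j′))
  ... | other i′ | at       = trans (ec i′) (sym (insertEntry-pk k s r c d i′))
  ... | other i′ | other j′ = sym (trans (insertEntry-pp k s r c d i′ j′) (entry-deleteAt t k i′ j′))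

deleteAt-alt : ∀ {n} (t : Raw (suc n)) k → IsAlt t → IsAlt (deleteAt t k)
deleteAt-alt t k A = record
  { outside = λ i j nc → trans (entry-deleteAt t k i j)
      (IsAlt.outside A _ _ (nc ∘ cell-deleteAt⁻ t k i j))
  ; leftOK  = λ i j j′ e cl lt → trans (entry-deleteAt t k i j′)
      (IsAlt.leftOK A _ _ _ (trans (sym (entry-deleteAt t k i j)) e) (cell-deleteAt⁺ t k i j′ cl) (punchIn-mono-< k lt))
  ; upOK    = λ i i′ j e cl lt → trans (entry-deleteAt t k i′ j)
      (IsAlt.upOK A _ _ _ (trans (sym (entry-deleteAt t k i j)) e) (cell-deleteAt⁺ t k i′ j cl) (punchIn-mono-< k lt))
  }

S-or-W : ∀ s → s ≡ S ⊎ s ≡ W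
S-or-W S = inj₁ refl
S-or-W W = inj₂ refl

S≢W : S ≢ W
S≢W ()

_≟Step_ : (a b : Step) → Dec (a ≡ b)
S ≟Step S = yes refl
S ≟Step W = no λ ()
W ≟Step S = no λ ()
W ≟Step W = yes refl

cell? : ∀ {n} (t : Raw n) i j → Dec (IsCell t i j)
cell? t i j = (stepAt t i ≟Step S) ×-dec ((stepAt t j ≟Step W) ×-dec (i <? j))

nonEmpty⇒cell : ∀ {n} {t : Raw n} → IsAlt t → ∀ i j → entry t i j ≢ emp → IsCell t i j
nonEmpty⇒cell {t = t} A i j ne with cell? t i j
... | yes c  = c
... | no  nc = ⊥-elim (ne (IsAlt.outside A i j nc))

column-of-S-empty : ∀ {n} {t : Raw n} → IsAlt t → ∀ {k} → stepAt t k ≡ S → ∀ i → entry t i k ≡ emp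
column-of-S-empty A sk i = IsAlt.outside A i _ (λ c → S≢W (trans (sym sk) (proj₁ (proj₂ c))))

row-of-W-empty : ∀ {n} {t : Raw n} → IsAlt t → ∀ {k} → stepAt t k ≡ W → ∀ j → entry t k j ≡ emp
row-of-W-empty A wk j = IsAlt.outside A _ j (λ c → S≢W (trans (sym (proj₁ c)) wk))

first-column-empty : ∀ {n} {t : Raw (suc n)} → IsAlt t → ∀ i → entry t i zero ≡ emp
first-column-empty A i = IsAlt.outside A i zero (λ { (_ , _ , ()) })

last-row-empty : ∀ {n} {t : Raw (suc n)} → IsAlt t → ∀ j → entry t (fromℕ n) j ≡ emp
last-row-empty A j = IsAlt.outside A _ j (λ c → fromℕ-maximal j (proj₂ (proj₂ c)))

isLeft⇒left : ∀ {f} → isLeft f ≡ true → f ≡ left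
isLeft⇒left {left} _ = refl

isUp⇒up : ∀ {f} → isUp f ≡ true → f ≡ up
isUp⇒up {up} _ = refl

isLeft-false : ∀ {f} → f ≢ left → isLeft f ≡ false
isLeft-false {emp}  _  = refl
isLeft-false {left} ne = ⊥-elim (ne refl)
isLeft-false {up}   _  = refl

isUp-false : ∀ {f} → f ≢ up → isUp f ≡ false
isUp-false {emp}  _  = refl
isUp-false {left} _  = refl
isUp-false {up}   ne = ⊥-elim (ne refl)

not-∧-true : ∀ u → not u ∧ true ≡ false → u ≡ true
not-∧-true true _ = refl

rowHasLeft colHasUp : ∀ {n} → Raw n → Fin n → Bool
rowHasLeft t i = anyFin (λ j → isLeft (entry t i j))
colHasUp   t j = anyFin (λ i → isUp (entry t i j))

isFreeRow-def : ∀ {n} (t : Raw n) i → isFreeRow t i ≡ isS (stepAt t i) ∧ not (rowHasLeft t i)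
isFreeRow-def t i = cong (λ b → isS (stepAt t i) ∧ not b) (any-tabulate (λ j → isLeft (entry t i j)) id)

isFreeCol-def : ∀ {n} (t : Raw n) j → isFreeCol t j ≡ isW (stepAt t j) ∧ not (colHasUp t j)
isFreeCol-def t j = cong (λ b → isW (stepAt t j) ∧ not b) (any-tabulate (λ i → isUp (entry t i j)) id)

freeRows-count : ∀ {n} (t : Raw n) → freeRows t ≡ countFin (isFreeRow t)
freeRows-count t = length-filter-tabulate (isFreeRow t) id

freeCols-count : ∀ {n} (t : Raw n) → freeCols t ≡ countFin (isFreeCol t)
freeCols-count t = length-filter-tabulate (isFreeCol t) id

freeRow-intro : ∀ {n} (t : Raw n) i → stepAt t i ≡ S → (∀ j → isLeft (entry t i j) ≡ false) → isFreeRow t i ≡ true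
freeRow-intro t i si none = trans (isFreeRow-def t i) (cong₂ (λ s b → isS s ∧ not b) si (anyFin-none none))

freeCol-intro : ∀ {n} (t : Raw n) j → stepAt t j ≡ W → (∀ i → isUp (entry t i j) ≡ false) → isFreeCol t j ≡ true
freeCol-intro t j wj none = trans (isFreeCol-def t j) (cong₂ (λ s b → isW s ∧ not b) wj (anyFin-none none))

freeRow⇒S : ∀ {n} (t : Raw n) i → isFreeRow t i ≡ true → stepAt t i ≡ S
freeRow⇒S t i free = isS-∧ (trans (sym (isFreeRow-def t i)) free)
  where isS-∧ : ∀ {s b} → isS s ∧ b ≡ true → s ≡ S
        isS-∧ {S} _ = refl

freeCol⇒W : ∀ {n} (t : Raw n) j → isFreeCol t j ≡ true → stepAt t j ≡ W
freeCol⇒W t j free = isW-∧ (trans (sym (isFreeCol-def t j)) free)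
  where isW-∧ : ∀ {s b} → isW s ∧ b ≡ true → s ≡ W
        isW-∧ {W} _ = refl

left⇒notFreeRow : ∀ {n} (t : Raw n) i j → entry t i j ≡ left → isFreeRow t i ≡ false
left⇒notFreeRow t i j e = trans (isFreeRow-def t i)
  (trans (cong (λ b → isS (stepAt t i) ∧ not b) (anyFin-intro j (cong isLeft e))) (∧-zeroʳ _))

up⇒notFreeCol : ∀ {n} (t : Raw n) i j → entry t i j ≡ up → isFreeCol t j ≡ false
up⇒notFreeCol t i j e = trans (isFreeCol-def t j)
  (trans (cong (λ b → isW (stepAt t j) ∧ not b) (anyFin-intro i (cong isUp e))) (∧-zeroʳ _))

notFreeRow⇒left : ∀ {n} (t : Raw n) i → isFreeRow t i ≡ false → stepAt t i ≡ S → ∃ λ j → entry t i j ≡ left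
notFreeRow⇒left t i notFree si =
  let (j , l) = anyFin-witness (forced (subst (λ s → isS s ∧ not (rowHasLeft t i) ≡ false) si
                                            (trans (sym (isFreeRow-def t i)) notFree)))
  in j , isLeft⇒left l
  where forced : ∀ {b} → isS S ∧ not b ≡ false → b ≡ true
        forced {true} _ = refl

notFreeCol⇒up : ∀ {n} (t : Raw n) j → isFreeCol t j ≡ false → stepAt t j ≡ W → ∃ λ i → entry t i j ≡ up
notFreeCol⇒up t j notFree wj =
  let (i , u) = anyFin-witness (forced (subst (λ s → isW s ∧ not (colHasUp t j) ≡ false) wj
                                            (trans (sym (isFreeCol-def t j)) notFree)))
  in i , isUp⇒up u
  where forced : ∀ {b} → isW W ∧ not b ≡ false → b ≡ true
        forced {true} _ = refl

∧-not-∨ : ∀ w u X → w ∧ not (u ∨ X) ≡ not u ∧ (w ∧ not X)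
∧-not-∨ w true  X = ∧-zeroʳ w
∧-not-∨ w false X = refl

isFreeRow-punchIn : ∀ {n} (t : Raw (suc n)) k i →
  isFreeRow t (punchIn k i) ≡ not (isLeft (entry t (punchIn k i) k)) ∧ isFreeRow (deleteAt t k) i
isFreeRow-punchIn {n} t k i = begin
  isFreeRow t (punchIn k i)
    ≡⟨ isFreeRow-def t (punchIn k i) ⟩
  isS (stepAt t (punchIn k i)) ∧ not (rowHasLeft t (punchIn k i))
    ≡⟨ cong₂ (λ s b → isS s ∧ not b) (sym (stepAt-deleteAt t k i)) splitRow ⟩
  isS (stepAt d i) ∧ not (isLeft e ∨ rowHasLeft d i)
    ≡⟨ ∧-not-∨ (isS (stepAt d i)) (isLeft e) (rowHasLeft d i) ⟩
  not (isLeft e) ∧ (isS (stepAt d i) ∧ not (rowHasLeft d i))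
    ≡⟨ cong (not (isLeft e) ∧_) (sym (isFreeRow-def d i)) ⟩
  not (isLeft e) ∧ isFreeRow d i
    ∎
  where
  open ≡-Reasoning
  d : Raw n
  d = deleteAt t k
  e : Fill
  e = entry t (punchIn k i) k
  splitRow : rowHasLeft t (punchIn k i) ≡ isLeft e ∨ rowHasLeft d i
  splitRow = trans (anyFin-punchIn k (λ j → isLeft (entry t (punchIn k i) j)))
                   (cong (isLeft e ∨_) (anyFin-cong (λ j → cong isLeft (sym (entry-deleteAt t k i j)))))

isFreeCol-punchIn : ∀ {n} (t : Raw (suc n)) k j →
  isFreeCol t (punchIn k j) ≡ not (isUp (entry t k (punchIn k j))) ∧ isFreeCol (deleteAt t k) j
isFreeCol-punchIn {n} t k j = begin
  isFreeCol t (punchIn k j)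
    ≡⟨ isFreeCol-def t (punchIn k j) ⟩
  isW (stepAt t (punchIn k j)) ∧ not (colHasUp t (punchIn k j))
    ≡⟨ cong₂ (λ s b → isW s ∧ not b) (sym (stepAt-deleteAt t k j)) splitCol ⟩
  isW (stepAt d j) ∧ not (isUp e ∨ colHasUp d j)
    ≡⟨ ∧-not-∨ (isW (stepAt d j)) (isUp e) (colHasUp d j) ⟩
  not (isUp e) ∧ (isW (stepAt d j) ∧ not (colHasUp d j))
    ≡⟨ cong (not (isUp e) ∧_) (sym (isFreeCol-def d j)) ⟩
  not (isUp e) ∧ isFreeCol d j
    ∎
  where
  open ≡-Reasoning
  d : Raw n
  d = deleteAt t k
  e : Fill
  e = entry t k (punchIn k j)
  splitCol : colHasUp t (punchIn k j) ≡ isUp e ∨ colHasUp d j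
  splitCol = trans (anyFin-punchIn k (λ i → isUp (entry t i (punchIn k j))))
                   (cong (isUp e ∨_) (anyFin-cong (λ i → cong isUp (sym (entry-deleteAt t k i j)))))

-- Deleting an S step removes its row and leaves the other rows' freeness
-- unchanged (its column is empty); dually for a W step.
freeRows-deleteAt : ∀ {n} (t : Raw (suc n)) k → IsAlt t → stepAt t k ≡ S →
                    freeRows t ≡ bit (isFreeRow t k) + freeRows (deleteAt t k)
freeRows-deleteAt {n} t k A sk = begin
  freeRows t                                                ≡⟨ freeRows-count t ⟩
  countFin (isFreeRow t)                                    ≡⟨ countFin-punchIn k (isFreeRow t) ⟩
  bit (isFreeRow t k) + countFin (isFreeRow t ∘ punchIn k)  ≡⟨ cong (bit (isFreeRow t k) +_) (countFin-cong unchanged) ⟩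
  bit (isFreeRow t k) + countFin (isFreeRow d)              ≡⟨ cong (bit (isFreeRow t k) +_) (sym (freeRows-count d)) ⟩
  bit (isFreeRow t k) + freeRows d                          ∎
  where
  open ≡-Reasoning
  d : Raw n
  d = deleteAt t k
  unchanged : ∀ i → isFreeRow t (punchIn k i) ≡ isFreeRow d i
  unchanged i = trans (isFreeRow-punchIn t k i)
    (cong (λ f → not (isLeft f) ∧ isFreeRow d i) (column-of-S-empty A sk (punchIn k i)))

freeCols-deleteAt : ∀ {n} (t : Raw (suc n)) k → IsAlt t → stepAt t k ≡ W →
                    freeCols t ≡ bit (isFreeCol t k) + freeCols (deleteAt t k)
freeCols-deleteAt {n} t k A wk = begin
  freeCols t                                                ≡⟨ freeCols-count t ⟩
  countFin (isFreeCol t)                                    ≡⟨ countFin-punchIn k (isFreeCol t) ⟩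
  bit (isFreeCol t k) + countFin (isFreeCol t ∘ punchIn k)  ≡⟨ cong (bit (isFreeCol t k) +_) (countFin-cong unchanged) ⟩
  bit (isFreeCol t k) + countFin (isFreeCol d)              ≡⟨ cong (bit (isFreeCol t k) +_) (sym (freeCols-count d)) ⟩
  bit (isFreeCol t k) + freeCols d                          ∎
  where
  open ≡-Reasoning
  d : Raw n
  d = deleteAt t k
  unchanged : ∀ j → isFreeCol t (punchIn k j) ≡ isFreeCol d j
  unchanged j = trans (isFreeCol-punchIn t k j)
    (cong (λ f → not (isUp f) ∧ isFreeCol d j) (row-of-W-empty A wk (punchIn k j)))

upIf : Bool → Fill
upIf true  = up
upIf false = emp

upIf-spec : ∀ {f} b → (b ≡ true → f ≡ up) → (b ≡ false → f ≡ emp) → f ≡ upIf b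
upIf-spec true  isUp  _      = isUp refl
upIf-spec false _     isEmp  = isEmp refl

-- Adding the entry upIf b on top of a column whose freeness is b leaves it non-free.
upIf-blocks : ∀ b → not (isUp (upIf b)) ∧ b ≡ false
upIf-blocks true  = refl
upIf-blocks false = refl

addTopRow : ∀ {n} → Raw n → Raw (suc n)
addTopRow t = insertStep zero S (λ j → upIf (isFreeCol t j)) (λ _ → emp) t

cutr-deleteAt : ∀ {n} (x : Raw (suc n)) → stepAt x zero ≡ S → cutr x ≡ deleteAt x zero
cutr-deleteAt x s0 = cong (λ m → deleteAt x (fromMaybe zero m)) (firstS-head (shape x) s0)
  where firstS-head : ∀ {n} (v : Vec Step (suc n)) → lookup v zero ≡ S → firstS v ≡ just zero
        firstS-head (S ∷ _) _ = refl

module _ {n} (t : Raw n) where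

  private
    r c : Fin n → Fill
    r j = upIf (isFreeCol t j)
    c _ = emp
    e : Raw (suc n)
    e = addTopRow t

  addTopRow-first : stepAt e zero ≡ S
  addTopRow-first = insertStep-at zero S r c t

  cutr-addTopRow : cutr e ≡ t
  cutr-addTopRow = trans (cutr-deleteAt e addTopRow-first) (deleteAt-insertStep zero S r c t)

  addTopRow-top≢left : ∀ j → entry e zero j ≢ left
  addTopRow-top≢left zero    l with () ← trans (sym (insertEntry-kk zero S r c t)) l
  addTopRow-top≢left (suc j) l = upIf≢left (isFreeCol t j) (trans (sym (insertEntry-kp zero S r c t j)) l)
    where upIf≢left : ∀ b → upIf b ≢ left
          upIf≢left true  ()
          upIf≢left false ()

  addTopRow-alt : IsAlt t → IsAlt e
  addTopRow-alt A = record { outside = out ; leftOK = lok ; upOK = uok }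
    where
    out : ∀ i j → ¬ IsCell e i j → entry e i j ≡ emp
    out zero    zero    _  = insertEntry-kk zero S r c t
    out zero    (suc j) nc = trans (insertEntry-kp zero S r c t j) (cong upIf (¬-not λ free →
      nc (addTopRow-first , trans (insertStep-other zero S r c t j) (freeCol⇒W t j free) , z<s)))
    out (suc i) zero    _  = insertEntry-pk zero S r c t i
    out (suc i) (suc j) nc = trans (insertEntry-pp zero S r c t i j)
      (IsAlt.outside A i j (nc ∘ cell-insertStep⁺ zero S r c t i j))
    -- the new row has no left arrow, the first column is empty, the rest is t
    lok : ∀ i j j′ → entry e i j ≡ left → IsCell e i j′ → j < j′ → entry e i j′ ≡ emp
    lok zero    j       _        l _  _  = ⊥-elim (addTopRow-top≢left j l)
    lok (suc i) zero    _        l _  _  with () ← trans (sym (insertEntry-pk zero S r c t i)) l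
    lok (suc i) (suc j) (suc j′) l cl lt = trans (insertEntry-pp zero S r c t i j′)
      (IsAlt.leftOK A i j j′ (trans (sym (insertEntry-pp zero S r c t i j)) l)
                    (cell-insertStep⁻ zero S r c t i j′ cl) (punchIn-cancel-< zero lt))
    -- an up arrow of t below the new row makes its column non-free in t
    uok : ∀ i i′ j → entry e i j ≡ up → IsCell e i′ j → i′ < i → entry e i′ j ≡ emp
    uok (suc i) _        zero    u _  _  with () ← trans (sym (insertEntry-pk zero S r c t i)) u
    uok (suc i) zero     (suc j) u _  _  = trans (insertEntry-kp zero S r c t j)
      (cong upIf (up⇒notFreeCol t i j (trans (sym (insertEntry-pp zero S r c t i j)) u)))
    uok (suc i) (suc i′) (suc j) u cl lt = trans (insertEntry-pp zero S r c t i′ j)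
      (IsAlt.upOK A i i′ j (trans (sym (insertEntry-pp zero S r c t i j)) u)
                  (cell-insertStep⁻ zero S r c t i′ j cl) (punchIn-cancel-< zero lt))

  freeCols-addTopRow : freeCols e ≡ 0
  freeCols-addTopRow = trans (freeCols-count e) (countFin-none notFree)
    where
    notFree : ∀ j → isFreeCol e j ≡ false
    notFree zero    = trans (isFreeCol-def e zero) (cong (λ s → isW s ∧ not (colHasUp e zero)) addTopRow-first)
    notFree (suc j) = begin
      isFreeCol e (suc j)                                          ≡⟨ isFreeCol-punchIn e zero j ⟩
      not (isUp (entry e zero (suc j))) ∧ isFreeCol (deleteAt e zero) j
        ≡⟨ cong₂ (λ f d → not (isUp f) ∧ isFreeCol d j) (insertEntry-kp zero S r c t j) (deleteAt-insertStep zero S r c t) ⟩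
      not (isUp (upIf (isFreeCol t j))) ∧ isFreeCol t j             ≡⟨ upIf-blocks (isFreeCol t j) ⟩
      false                                                        ∎
      where open ≡-Reasoning

  freeRows-addTopRow : IsAlt t → freeRows e ≡ suc (freeRows t)
  freeRows-addTopRow A = begin
    freeRows e                                          ≡⟨ freeRows-deleteAt e zero (addTopRow-alt A) addTopRow-first ⟩
    bit (isFreeRow e zero) + freeRows (deleteAt e zero) ≡⟨ cong₂ (λ b d → bit b + freeRows d) topFree (deleteAt-insertStep zero S r c t) ⟩
    suc (freeRows t)                                    ∎
    where
    open ≡-Reasoning
    topFree : isFreeRow e zero ≡ true
    topFree = freeRow-intro e zero addTopRow-first (isLeft-false ∘ addTopRow-top≢left)

-- A tableau without free column is determined by its cut: its top row is the one added by addTopRow.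
module _ {n} (x : Raw (suc n)) (A : IsAlt x) (noFreeCol : freeCols x ≡ 0) where

  private
    colNotFree : ∀ j → isFreeCol x j ≡ false
    colNotFree = countFin-zero (trans (sym (freeCols-count x)) noFreeCol)
    d : Raw n
    d = deleteAt x zero

  -- a first step W would be an empty, hence free, column
  noFreeCol-first : stepAt x zero ≡ S
  noFreeCol-first with S-or-W (stepAt x zero)
  ... | inj₁ s0 = s0
  ... | inj₂ w0 with () ← trans (sym (freeCol-intro x zero w0 (cong isUp ∘ first-column-empty A))) (colNotFree zero)

  cutr-alt : IsAlt (cutr x)
  cutr-alt = subst IsAlt (sym (cutr-deleteAt x noFreeCol-first)) (deleteAt-alt x zero A)

  -- a left arrow in the top row would lie above the up arrow of its (non-free) column
  noFreeCol-top≢left : ∀ j → entry x zero j ≢ left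
  noFreeCol-top≢left j l = noUp (notFreeCol⇒up x j (colNotFree j) (proj₁ (proj₂ cell)))
    where
    cell : IsCell x zero j
    cell = nonEmpty⇒cell A zero j (λ em → case (trans (sym l) em))
      where case : left ≢ emp
            case ()
    noUp : ¬ ∃ λ i → entry x i j ≡ up
    noUp (zero  , u) with () ← trans (sym l) u
    noUp (suc i , u) with () ← trans (sym l) (IsAlt.upOK A (suc i) zero j u cell z<s)

  -- the top row is free, so if it is the only free row the cut has none
  freeRows-cutr : freeRows x ≡ 1 → freeRows (cutr x) ≡ 0
  freeRows-cutr one = suc-injective (begin
    suc (freeRows (cutr x))                    ≡⟨ cong (λ b → bit b + freeRows (cutr x)) (sym topFree) ⟩
    bit (isFreeRow x zero) + freeRows (cutr x) ≡⟨ cong (λ y → bit (isFreeRow x zero) + freeRows y) (cutr-deleteAt x noFreeCol-first) ⟩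
    bit (isFreeRow x zero) + freeRows d        ≡⟨ sym (freeRows-deleteAt x zero A noFreeCol-first) ⟩
    freeRows x                                 ≡⟨ one ⟩
    1                                          ∎)
    where
    open ≡-Reasoning
    topFree : isFreeRow x zero ≡ true
    topFree = freeRow-intro x zero noFreeCol-first (isLeft-false ∘ noFreeCol-top≢left)

  noFreeCol-top : ∀ j → entry x zero (suc j) ≡ upIf (isFreeCol d j)
  noFreeCol-top j = upIf-spec (isFreeCol d j) freeBelow notFreeBelow
    where
    freeBelow : isFreeCol d j ≡ true → entry x zero (suc j) ≡ up
    freeBelow free = isUp⇒up (not-∧-true _
      (trans (sym (trans (isFreeCol-punchIn x zero j) (cong (not (isUp (entry x zero (suc j))) ∧_) free)))
             (colNotFree (suc j))))
    notFreeBelow : isFreeCol d j ≡ false → entry x zero (suc j) ≡ emp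
    notFreeBelow nf with S-or-W (stepAt d j)
    ... | inj₁ sj = column-of-S-empty A (trans (sym (stepAt-deleteAt x zero j)) sj) zero
    ... | inj₂ sj = let (i , u) = notFreeCol⇒up d j nf sj in
      IsAlt.upOK A (suc i) zero (suc j) (trans (sym (entry-deleteAt x zero i j)) u)
                 (noFreeCol-first , trans (sym (stepAt-deleteAt x zero j)) sj , z<s) z<s

  addTopRow-cutr : x ≡ addTopRow (cutr x)
  addTopRow-cutr =
    trans (insertStep-deleteAt x zero S (λ j → upIf (isFreeCol d j)) (λ _ → emp) noFreeCol-first
                               (first-column-empty A zero) noFreeCol-top (first-column-empty A ∘ suc))
          (cong addTopRow (sym (cutr-deleteAt x noFreeCol-first)))

leftIf : Bool → Fill
leftIf true  = left
leftIf false = emp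

leftIf-spec : ∀ {f} b → (b ≡ true → f ≡ left) → (b ≡ false → f ≡ emp) → f ≡ leftIf b
leftIf-spec true  isLeft _     = isLeft refl
leftIf-spec false _      isEmp = isEmp refl

leftIf-blocks : ∀ b → not (isLeft (leftIf b)) ∧ b ≡ false
leftIf-blocks true  = refl
leftIf-blocks false = refl

addLeftColumn : ∀ {n} → Raw n → Raw (suc n)
addLeftColumn {n} t = insertStep (fromℕ n) W (λ _ → emp) (λ i → leftIf (isFreeRow t i)) t

cutc-deleteAt : ∀ {n} (x : Raw (suc n)) → stepAt x (fromℕ n) ≡ W → cutc x ≡ deleteAt x (fromℕ n)
cutc-deleteAt {n} x wL = cong (λ m → deleteAt x (fromMaybe (fromℕ n) m)) (lastW-last (shape x) wL)
  where lastW-last : ∀ {n} (v : Vec Step (suc n)) → lookup v (fromℕ n) ≡ W → lastW v ≡ just (fromℕ n)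
        lastW-last {zero}  (W ∷ [])  _  = refl
        lastW-last {suc n} (_ ∷ xs)  wL rewrite lastW-last xs wL = refl

module _ {n} (t : Raw n) where

  private
    L : Fin (suc n)
    L = fromℕ n
    r c : Fin n → Fill
    r _ = emp
    c i = leftIf (isFreeRow t i)
    e : Raw (suc n)
    e = addLeftColumn t

  addLeftColumn-last : stepAt e L ≡ W
  addLeftColumn-last = insertStep-at L W r c t

  cutc-addLeftColumn : cutc e ≡ t
  cutc-addLeftColumn = trans (cutc-deleteAt e addLeftColumn-last) (deleteAt-insertStep L W r c t)

  addLeftColumn-new≢up : ∀ i → entry e i L ≢ up
  addLeftColumn-new≢up i u with position L i
  ... | at       with () ← trans (sym (insertEntry-kk L W r c t)) u
  ... | other i′ = leftIf≢up (isFreeRow t i′) (trans (sym (insertEntry-pk L W r c t i′)) u)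
    where leftIf≢up : ∀ b → leftIf b ≢ up
          leftIf≢up true  ()
          leftIf≢up false ()

  addLeftColumn-alt : IsAlt t → IsAlt e
  addLeftColumn-alt A = record { outside = out ; leftOK = lok ; upOK = uok }
    where
    lastRow : ∀ j → entry e L j ≡ emp
    lastRow j with position L j
    ... | at       = insertEntry-kk L W r c t
    ... | other j′ = insertEntry-kp L W r c t j′
    out : ∀ i j → ¬ IsCell e i j → entry e i j ≡ emp
    out i j nc with position L i | position L j
    ... | at       | _        = lastRow j
    ... | other i′ | at       = trans (insertEntry-pk L W r c t i′) (cong leftIf (¬-not λ free →
      nc (trans (insertStep-other L W r c t i′) (freeRow⇒S t i′ free) , addLeftColumn-last , punchIn-fromℕ-< i′)))
    ... | other i′ | other j′ = trans (insertEntry-pp L W r c t i′ j′)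
      (IsAlt.outside A i′ j′ (nc ∘ cell-insertStep⁺ L W r c t i′ j′))
    -- a left arrow of t makes its row non-free in t, so the new column is empty there
    lok : ∀ i j j′ → entry e i j ≡ left → IsCell e i j′ → j < j′ → entry e i j′ ≡ emp
    lok i j j′ l cl lt with position L i | position L j
    ... | at       | _  with () ← trans (sym (lastRow j)) l
    ... | other i′ | at = ⊥-elim (fromℕ-maximal j′ lt)
    ... | other i′ | other j₀ with position L j′
    ...   | at       = trans (insertEntry-pk L W r c t i′)
      (cong leftIf (left⇒notFreeRow t i′ j₀ (trans (sym (insertEntry-pp L W r c t i′ j₀)) l)))
    ...   | other j₁ = trans (insertEntry-pp L W r c t i′ j₁)
      (IsAlt.leftOK A i′ j₀ j₁ (trans (sym (insertEntry-pp L W r c t i′ j₀)) l)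
                    (cell-insertStep⁻ L W r c t i′ j₁ cl) (punchIn-cancel-< L lt))
    -- the new column has no up arrow and the new step W carries no row
    uok : ∀ i i′ j → entry e i j ≡ up → IsCell e i′ j → i′ < i → entry e i′ j ≡ emp
    uok i i′ j u cl lt with position L j
    ... | at = ⊥-elim (addLeftColumn-new≢up i u)
    ... | other j′ with position L i | position L i′
    ...   | at       | _        with () ← trans (sym (lastRow (punchIn L j′))) u
    ...   | other _  | at       with () ← trans (sym addLeftColumn-last) (proj₁ cl)
    ...   | other i₀ | other i₁ = trans (insertEntry-pp L W r c t i₁ j′)
      (IsAlt.upOK A i₀ i₁ j′ (trans (sym (insertEntry-pp L W r c t i₀ j′)) u)
                  (cell-insertStep⁻ L W r c t i₁ j′ cl) (punchIn-cancel-< L lt))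

  freeRows-addLeftColumn : freeRows e ≡ 0
  freeRows-addLeftColumn = trans (freeRows-count e) (countFin-none notFree)
    where
    notFree : ∀ i → isFreeRow e i ≡ false
    notFree i with position L i
    ... | at       = trans (isFreeRow-def e L) (cong (λ s → isS s ∧ not (rowHasLeft e L)) addLeftColumn-last)
    ... | other i′ = begin
      isFreeRow e (punchIn L i′)                                          ≡⟨ isFreeRow-punchIn e L i′ ⟩
      not (isLeft (entry e (punchIn L i′) L)) ∧ isFreeRow (deleteAt e L) i′
        ≡⟨ cong₂ (λ f d → not (isLeft f) ∧ isFreeRow d i′) (insertEntry-pk L W r c t i′) (deleteAt-insertStep L W r c t) ⟩
      not (isLeft (leftIf (isFreeRow t i′))) ∧ isFreeRow t i′             ≡⟨ leftIf-blocks (isFreeRow t i′) ⟩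
      false                                                              ∎
      where open ≡-Reasoning

  freeCols-addLeftColumn : IsAlt t → freeCols e ≡ suc (freeCols t)
  freeCols-addLeftColumn A = begin
    freeCols e                                    ≡⟨ freeCols-deleteAt e L (addLeftColumn-alt A) addLeftColumn-last ⟩
    bit (isFreeCol e L) + freeCols (deleteAt e L) ≡⟨ cong₂ (λ b d → bit b + freeCols d) newFree (deleteAt-insertStep L W r c t) ⟩
    suc (freeCols t)                              ∎
    where
    open ≡-Reasoning
    newFree : isFreeCol e L ≡ true
    newFree = freeCol-intro e L addLeftColumn-last (isUp-false ∘ addLeftColumn-new≢up)

-- A tableau without free row is determined by its cut: its leftmost column is the one added by addLeftColumn.
module _ {n} (x : Raw (suc n)) (A : IsAlt x) (noFreeRow : freeRows x ≡ 0) where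

  private
    L : Fin (suc n)
    L = fromℕ n
    rowNotFree : ∀ i → isFreeRow x i ≡ false
    rowNotFree = countFin-zero (trans (sym (freeRows-count x)) noFreeRow)
    d : Raw n
    d = deleteAt x L

  -- a last step S would be an empty, hence free, row
  noFreeRow-last : stepAt x L ≡ W
  noFreeRow-last with S-or-W (stepAt x L)
  ... | inj₂ wL = wL
  ... | inj₁ sL with () ← trans (sym (freeRow-intro x L sL (cong isLeft ∘ last-row-empty A))) (rowNotFree L)

  cutc-alt : IsAlt (cutc x)
  cutc-alt = subst IsAlt (sym (cutc-deleteAt x noFreeRow-last)) (deleteAt-alt x L A)

  -- an up arrow in the leftmost column would lie left of the left arrow of its (non-free) row
  noFreeRow-last≢up : ∀ i → entry x i L ≢ up
  noFreeRow-last≢up i u = noLeft (notFreeRow⇒left x i (rowNotFree i) (proj₁ cell))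
    where
    cell : IsCell x i L
    cell = nonEmpty⇒cell A i L (λ em → case (trans (sym u) em))
      where case : up ≢ emp
            case ()
    noLeft : ¬ ∃ λ j → entry x i j ≡ left
    noLeft (j , l) with position L j
    ... | at       with () ← trans (sym u) l
    ... | other j′ with () ← trans (sym u) (IsAlt.leftOK A i (punchIn L j′) L l cell (punchIn-fromℕ-< j′))

  -- the leftmost column is free, so if it is the only free column the cut has none
  freeCols-cutc : freeCols x ≡ 1 → freeCols (cutc x) ≡ 0
  freeCols-cutc one = suc-injective (begin
    suc (freeCols (cutc x))                 ≡⟨ cong (λ b → bit b + freeCols (cutc x)) (sym lastFree) ⟩
    bit (isFreeCol x L) + freeCols (cutc x) ≡⟨ cong (λ y → bit (isFreeCol x L) + freeCols y) (cutc-deleteAt x noFreeRow-last) ⟩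
    bit (isFreeCol x L) + freeCols d        ≡⟨ sym (freeCols-deleteAt x L A noFreeRow-last) ⟩
    freeCols x                              ≡⟨ one ⟩
    1                                       ∎)
    where
    open ≡-Reasoning
    lastFree : isFreeCol x L ≡ true
    lastFree = freeCol-intro x L noFreeRow-last (isUp-false ∘ noFreeRow-last≢up)

  noFreeRow-left : ∀ i → entry x (punchIn L i) L ≡ leftIf (isFreeRow d i)
  noFreeRow-left i = leftIf-spec (isFreeRow d i) freeRest notFreeRest
    where
    freeRest : isFreeRow d i ≡ true → entry x (punchIn L i) L ≡ left
    freeRest free = isLeft⇒left (not-∧-true _
      (trans (sym (trans (isFreeRow-punchIn x L i) (cong (not (isLeft (entry x (punchIn L i) L)) ∧_) free)))
             (rowNotFree (punchIn L i))))
    notFreeRest : isFreeRow d i ≡ false → entry x (punchIn L i) L ≡ emp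
    notFreeRest nf with S-or-W (stepAt d i)
    ... | inj₂ wi = row-of-W-empty A (trans (sym (stepAt-deleteAt x L i)) wi) L
    ... | inj₁ si = let (j , l) = notFreeRow⇒left d i nf si in
      IsAlt.leftOK A (punchIn L i) (punchIn L j) L (trans (sym (entry-deleteAt x L i j)) l)
                   (trans (sym (stepAt-deleteAt x L i)) si , noFreeRow-last , punchIn-fromℕ-< i) (punchIn-fromℕ-< j)

  addLeftColumn-cutc : x ≡ addLeftColumn (cutc x)
  addLeftColumn-cutc =
    trans (insertStep-deleteAt x L W (λ _ → emp) (λ i → leftIf (isFreeRow d i)) noFreeRow-last
                               (last-row-empty A L) (last-row-empty A ∘ punchIn L) noFreeRow-left)
          (cong addLeftColumn (sym (cutc-deleteAt x noFreeRow-last)))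

record Retraction {A B : Set} (P : A → Set) (Q : B → Set) (c : B → A) : Set where
  field
    ext      : A → B
    c-ext    : ∀ a → c (ext a) ≡ a
    ext-pres : ∀ a → P a → Q (ext a)
    c-pres   : ∀ b → Q b → P (c b)
    ext-c    : ∀ b → Q b → b ≡ ext (c b)

  bijOn : BijOn c Q P
  bijOn = c-pres
        , (λ x y qx qy eq → trans (ext-c x qx) (trans (cong ext eq) (sym (ext-c y qy))))
        , (λ a pa → ext a , ext-pres a pa , c-ext a)

open Retraction using (bijOn)

card-transport : ∀ {m} {P : Raw m → Set} {Q : Raw (suc m) → Set} {c : Raw (suc m) → Raw m} →
                 Retraction P Q c → ∀ {k} → HasCard P k → HasCard Q k
card-transport {P = P} {Q} {c} R (l , unique , member , len) =
  List.map ext l , map⁺ ext-injective unique , member′ , trans (length-map ext l) len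
  where
  open Retraction R
  ext-injective : ∀ {a b} → ext a ≡ ext b → a ≡ b
  ext-injective {a} {b} eq = trans (sym (c-ext a)) (trans (cong c eq) (c-ext b))
  member′ : ∀ x → (x ∈ List.map ext l) ⇔ Q x
  member′ x = mk⇔
    (λ x∈ → let (a , a∈ , x≡) = ∈-map⁻ ext x∈ in subst Q (sym x≡) (ext-pres a (Equivalence.to (member a) a∈)))
    (λ qx → subst (_∈ List.map ext l) (sym (ext-c x qx)) (∈-map⁺ ext (Equivalence.from (member (c x)) (c-pres x qx))))

cutr-𝒜*0 : ∀ n → Retraction (𝒜 n) (𝒜*0 (suc n)) cutr
cutr-𝒜*0 n = record
  { ext      = addTopRow
  ; c-ext    = cutr-addTopRow
  ; ext-pres = λ t A → addTopRow-alt t A , freeCols-addTopRow t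
  ; c-pres   = λ x (A , fc) → cutr-alt x A fc
  ; ext-c    = λ x (A , fc) → addTopRow-cutr x A fc
  }

cutr-𝒜10 : ∀ n → Retraction (𝒜0* n) (𝒜10 (suc n)) cutr
cutr-𝒜10 n = record
  { ext      = addTopRow
  ; c-ext    = cutr-addTopRow
  ; ext-pres = λ t (A , fr) → addTopRow-alt t A , trans (freeRows-addTopRow t A) (cong suc fr) , freeCols-addTopRow t
  ; c-pres   = λ x (A , fr , fc) → cutr-alt x A fc , freeRows-cutr x A fc fr
  ; ext-c    = λ x (A , _ , fc) → addTopRow-cutr x A fc
  }

cutc-𝒜0* : ∀ n → Retraction (𝒜 n) (𝒜0* (suc n)) cutc
cutc-𝒜0* n = record
  { ext      = addLeftColumn
  ; c-ext    = cutc-addLeftColumn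
  ; ext-pres = λ t A → addLeftColumn-alt t A , freeRows-addLeftColumn t
  ; c-pres   = λ x (A , fr) → cutc-alt x A fr
  ; ext-c    = λ x (A , fr) → addLeftColumn-cutc x A fr
  }

cutc-𝒜01 : ∀ n → Retraction (𝒜*0 n) (𝒜01 (suc n)) cutc
cutc-𝒜01 n = record
  { ext      = addLeftColumn
  ; c-ext    = cutc-addLeftColumn
  ; ext-pres = λ t (A , fc) → addLeftColumn-alt t A , freeRows-addLeftColumn t , trans (freeCols-addLeftColumn t A) (cong suc fc)
  ; c-pres   = λ x (A , fr , fc) → cutc-alt x A fr , freeCols-cutc x A fr fc
  ; ext-c    = λ x (A , fr , _) → addLeftColumn-cutc x A fr
  }

-- Finiteness of 𝒜(n): brute-force enumeration of raw tableaux, filtered by a decision procedure.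
_≟Fill_ : (a b : Fill) → Dec (a ≡ b)
emp  ≟Fill emp  = yes refl
emp  ≟Fill left = no λ ()
emp  ≟Fill up   = no λ ()
left ≟Fill emp  = no λ ()
left ≟Fill left = yes refl
left ≟Fill up   = no λ ()
up   ≟Fill emp  = no λ ()
up   ≟Fill left = no λ ()
up   ≟Fill up   = yes refl

-- Being an alternative tableau is decidable: its three conditions quantify over Fin only.
isAlt? : ∀ {n} (t : Raw n) → Dec (IsAlt t)
isAlt? t = map′ (λ (o , l , u) → record { outside = o ; leftOK = l ; upOK = u })
                (λ A → IsAlt.outside A , IsAlt.leftOK A , IsAlt.upOK A)
  (all? (λ i → all? (λ j → ¬? (cell? t i j) →-dec (entry t i j ≟Fill emp)))
   ×-dec all? (λ i → all? (λ j → all? (λ j′ →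
           (entry t i j ≟Fill left) →-dec (cell? t i j′ →-dec (j <? j′ →-dec (entry t i j′ ≟Fill emp))))))
   ×-dec all? (λ i → all? (λ i′ → all? (λ j →
           (entry t i j ≟Fill up) →-dec (cell? t i′ j →-dec (i′ <? i →-dec (entry t i′ j ≟Fill emp)))))))

vectors : ∀ {A : Set} → List A → ∀ n → List (Vec A n)
vectors l zero    = [] List.∷ List.[]
vectors l (suc n) = cartesianProductWith _∷_ l (vectors l n)

vectors-unique : ∀ {A : Set} {l : List A} → Unique l → ∀ n → Unique (vectors l n)
vectors-unique u zero    = [] ∷ []
vectors-unique u (suc n) =
  cartesianProductWith⁺ _∷_ (λ e → ∷-injectiveˡ e , ∷-injectiveʳ e) u (vectors-unique u n)

vectors-complete : ∀ {A : Set} {l : List A} → (∀ a → a ∈ l) → ∀ {n} (v : Vec A n) → v ∈ vectors l n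
vectors-complete all []      = here refl
vectors-complete all (a ∷ v) = ∈-cartesianProductWith⁺ _∷_ (all a) (vectors-complete all v)

steps : List Step
steps = S List.∷ W List.∷ List.[]

fills : List Fill
fills = emp List.∷ left List.∷ up List.∷ List.[]

steps-unique : Unique steps
steps-unique = ((λ ()) ∷ []) ∷ ([] ∷ [])

fills-unique : Unique fills
fills-unique = ((λ ()) ∷ (λ ()) ∷ []) ∷ (((λ ()) ∷ []) ∷ ([] ∷ []))

steps-complete : ∀ s → s ∈ steps
steps-complete S = here refl
steps-complete W = there (here refl)

fills-complete : ∀ f → f ∈ fills
fills-complete emp  = here refl
fills-complete left = there (here refl)
fills-complete up   = there (there (here refl))

raws : ∀ n → List (Raw n)
raws n = cartesianProductWith raw (vectors steps n) (vectors (vectors fills n) n)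

raws-unique : ∀ n → Unique (raws n)
raws-unique n = cartesianProductWith⁺ raw (λ e → cong shape e , cong fill e)
  (vectors-unique steps-unique n) (vectors-unique (vectors-unique fills-unique n) n)

raws-complete : ∀ {n} (t : Raw n) → t ∈ raws n
raws-complete (raw s f) = ∈-cartesianProductWith⁺ raw
  (vectors-complete steps-complete s) (vectors-complete (vectors-complete fills-complete) f)

card-𝒜 : ∀ n → HasCard (𝒜 n) (length (filter isAlt? (raws n)))
card-𝒜 n = filter isAlt? (raws n) , filter⁺ isAlt? (raws-unique n)
         , (λ t → mk⇔ (proj₂ ∘ ∈-filter⁻ isAlt? {xs = raws n}) (∈-filter⁺ isAlt? (raws-complete t)))
         , refl

corollary2p6 : (n : ℕ) →
    (BijOn cutr (𝒜*0 (suc n)) (𝒜 n) × BijOn cutr (𝒜10 (suc n)) (𝒜0* n)) ×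
    (BijOn cutc (𝒜0* (suc n)) (𝒜 n) × BijOn cutc (𝒜01 (suc n)) (𝒜*0 n)) ×
    ∃ (λ k → HasCard (𝒜 n) k × HasCard (𝒜0* (suc n)) k × HasCard (𝒜*0 (suc n)) k
           × HasCard (𝒜01 (suc (suc n))) k × HasCard (𝒜10 (suc (suc n))) k)
corollary2p6 n =
  (bijOn (cutr-𝒜*0 n) , bijOn (cutr-𝒜10 n)) ,
  (bijOn (cutc-𝒜0* n) , bijOn (cutc-𝒜01 n)) ,
  k , card𝒜 , card𝒜0* , card𝒜*0 ,
  card-transport (cutc-𝒜01 (suc n)) card𝒜*0 ,
  card-transport (cutr-𝒜10 (suc n)) card𝒜0*
  where
  k : ℕ
  k = length (filter isAlt? (raws n))
  card𝒜 : HasCard (𝒜 n) k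
  card𝒜 = card-𝒜 n
  card𝒜0* : HasCard (𝒜0* (suc n)) k
  card𝒜0* = card-transport (cutc-𝒜0* n) card𝒜
  card𝒜*0 : HasCard (𝒜*0 (suc n)) k
  card𝒜*0 = card-transport (cutr-𝒜*0 n) card𝒜
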